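{- Let $r>1$ be an integer and $q$ a power of an odd prime with $q\equiv 1\pmod r$; let $\zeta\in\mathbb{F}_q^{\ast}$ be an element of order $r$. Let $m,d$ be positive integers with $q-1=md$, $d$ a multiple of $r$, and $\varphi(m)\ge r$. Let $u_0,\ldots,u_{r-1}\in\mathbb{F}_q^{\ast}$, not all the same, where $u_i$ has multiplicative order $m_i$ dividing $m$, and write $n_i=m/m_i$. Let $G(x)\in\mathbb{F}_q[x]$ be the polynomial of degree at most $r-1$ with $G(\zeta^k)=u_k$ for $k=0,\ldots,r-1$, let $\ell=(q-1)/r$ and $f(x)=xG(x^{\ell})$. Then: (i) $f$ is a permutation polynomial of $\mathbb{F}_q$; (ii) the permutation induced by $f$ has cycle type $1+m_0^{dn_0/r}+m_1^{dn_1/r}+\cdots+m_{r-1}^{dn_{r-1}/r}$; (iii) the inverse permutation is induced by a polynomial $xG'(x^{\ell})$ involving the same powers of $x$ as $f$, where $G'$ has degree at most $r-1$ and $G'(\zeta^k)=u_k^{ -1}$ for $k=0,\ldots,r-1$.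
   Context: $\varphi$ is Euler's totient function. The order of a nonzero element means its order in $\mathbb{F}_q^{\ast}$. A cycle type $1+m_0^{k_0}+\cdots+m_{r-1}^{k_{r-1}}$ means exactly one fixed point and otherwise $k_i$ disjoint cycles of length $m_i$ for each $i$ (counts adding when some $m_i$ coincide). -}

module Defs where

open import Data.Nat using (ℕ; zero; suc; _≤_; _<_)
open import Data.Nat.DivMod using (_/_)
open import Data.Nat.GCD using (gcd)
open import Data.Fin using (Fin; toℕ)
open import Data.Fin.Properties using () renaming (_≟_ to _≟ᶠ_)
open import Data.List using (List; map; length; filterᵇ; allFin; upTo)
open import Data.Product using (_×_)
open import Data.Bool using (Bool; true; false; _∧_; not)
open import Relation.Nullary using (does; ¬_)
open import Relation.Binary.PropositionalEquality using (_≡_; _≢_)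
open import Algebra.Core using (Op₁; Op₂)
open import Algebra.Structures using (IsCommutativeRing)
open import Function.Bundles using (_↔_; Inverse)
import Data.Nat as ℕ

-- Division of naturals, only ever used with a nonzero divisor
-- (a div 0 is set to 0 by convention and never occurs in the statement).
_div_ : ℕ → ℕ → ℕ
a div zero    = 0
a div (suc b) = a / suc b

φ : ℕ → ℕ
φ m = length (filterᵇ (λ k → does (gcd (suc k) m ℕ.≟ 1)) (upTo m))

record FiniteField (q : ℕ) : Set₁ where
  infixl 7 _*_
  infixl 6 _+_
  field
    Carrier : Set
    _+_ _*_ : Op₂ Carrier
    -_      : Op₁ Carrier
    0# 1#   : Carrier
    _⁻¹     : Op₁ Carrier
    isCommutativeRing : IsCommutativeRing _≡_ _+_ _*_ -_ 0# 1#
    0≢1     : 0# ≢ 1#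
    inverseʳ : ∀ x → x ≢ 0# → x * (x ⁻¹) ≡ 1#
    enum    : Fin q ↔ Carrier

  infixr 8 _^_
  _^_ : Carrier → ℕ → Carrier
  x ^ zero  = 1#
  x ^ suc n = x * (x ^ n)

  HasOrder : Carrier → ℕ → Set
  HasOrder x k = 1 ≤ k × (x ^ k ≡ 1#) × (∀ j → 1 ≤ j → j < k → x ^ j ≢ 1#)

  -- evaluation of the polynomial Σ_{j<r} c_j X^j (degree ≤ r-1)
  evalPoly : ∀ {r} → (Fin r → Carrier) → Carrier → Carrier
  evalPoly {r} c x = go r c
    where
    go : ∀ n → (Fin n → Carrier) → Carrier
    go zero    c = 0#
    go (suc n) c = c Fin.zero + x * go n (λ j → c (Fin.suc j))
      where import Data.Fin as Fin

  elements : List Carrier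
  elements = map (Inverse.to enum) (allFin q)

  _==_ : Carrier → Carrier → Bool
  x == y = does (Inverse.from enum x ≟ᶠ Inverse.from enum y)

  iter : (Carrier → Carrier) → ℕ → Carrier → Carrier
  iter f zero    x = x
  iter f (suc k) x = f (iter f k x)

  noReturn : (Carrier → Carrier) → ℕ → Carrier → Bool
  noReturn f zero    x = true
  noReturn f (suc k) x = not (iter f (suc k) x == x) ∧ noReturn f k x

  onCycleOfLength : (Carrier → Carrier) → ℕ → Carrier → Bool
  onCycleOfLength f zero    x = false
  onCycleOfLength f (suc n) x = (iter f (suc n) x == x) ∧ noReturn f n x

  numCycles : (Carrier → Carrier) → ℕ → ℕ
  numCycles f L = length (filterᵇ (onCycleOfLength f L) elements) div L

-- Fermat gives (x^ℓ)^r = 1 for x ≠ 0, and X^r − 1 has at most r roots, so x^ℓ = ζ^k for some k: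
-- the units split into r fibres x^ℓ = ζ^k. Each fibre has at most ℓ elements (roots of
-- X^ℓ − ζ^k) and together they cover the q − 1 = rℓ units, so each has exactly ℓ. On the k-th
-- fibre f is multiplication by u_k, which maps the fibre to itself because u_k^ℓ = 1 (m_k ∣ m ∣ ℓ);
-- hence every point of it lies on a cycle of length m_k, and the fibre consists of
-- ℓ / m_k = d n_k / r such cycles. The inverse acts on the k-th fibre as multiplication by
-- u_k^(m−1) = u_k⁻¹ and is realised by G' = G^(m−1) reduced modulo X^r − 1, which interpolates
-- the values u_k^(m−1) at the r-th roots of unity.
module Submission where

open import Defs
open import Data.Nat using (ℕ; _≤_; _<_; _∸_; _≡ᵇ_) renaming (_^_ to _^ℕ_; _*_ to _*ℕ_; _+_ to _+ℕ_)
open import Data.Nat.Divisibility using (_∣_)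
open import Data.Nat.Primality using (Prime)
open import Data.Fin using (Fin; toℕ)
open import Data.List using (map; allFin)
open import Data.Nat.ListAction using (sum)
open import Data.Bool using (if_then_else_)
open import Data.Product using (_×_; Σ; ∃; ∃-syntax; _,_)
open import Relation.Nullary using (¬_)
open import Relation.Binary.PropositionalEquality using (_≡_; _≢_)
open import Function.Definitions using (Bijective)

open import Algebra.Bundles using (CommutativeSemiring; CommutativeMonoid)
open import Algebra.Structures using (IsCommutativeRing)
import Algebra.Properties.Semiring.Sum as SemiringSum
open import Data.Bool using (Bool; true; false)
open import Data.Bool.Properties using (∧-zeroʳ)
open import Data.Fin using (zero; suc; punchIn)
open import Data.Fin.Permutation using (Permutation; permutation)
open import Data.Fin.Properties using (punchInᵢ≢i; any?; toℕ-injective; toℕ<n) renaming (_≟_ to _≟ᶠ_)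
open import Data.List using ([]; _∷_; tabulate; length; filterᵇ)
open import Data.List.Properties using (map-tabulate)
open import Data.Nat using (zero; suc; z≤n; s≤s)
import Data.Nat as ℕ
import Data.Nat.Properties as ℕ
open import Data.Nat.DivMod using (_/_; m*n/n≡m; n/1≡n)
open import Data.Nat.Divisibility using (divides; ∣-trans; m∣m*n; n∣m*n)
open import Data.Nat.Tactic.RingSolver using (solve-∀)
open import Data.Product using (proj₁)
open import Data.Sum using (inj₁; inj₂)
open import Data.Vec.Functional using (head; tail; init; last; zipWith; replicate)
  renaming (_∷_ to _∷ᵛ_; map to mapᵛ)
open import Function using (_∘_)
open import Function.Bundles using (Inverse)
open import Function.Consequences.Propositional
  using (inverseᵇ⇒bijective; strictlyInverseˡ⇒inverseˡ; strictlyInverseʳ⇒inverseʳ)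
open import Function.Definitions using (Injective)
open import Relation.Binary.Definitions using (DecidableEquality; tri<; tri≈; tri>)
open import Relation.Binary.PropositionalEquality
  using (refl; sym; trans; cong; cong₂; subst; module ≡-Reasoning)
open import Relation.Nullary using (yes; no; contradiction)
open import Relation.Nullary.Decidable using (dec-true; dec-false; map′)

open SemiringSum ℕ.+-*-semiring
  using (sum-syntax; sum-cong-≗; sum-replicate-zero; sum-remove; ∑-distrib-+; ∑-comm; *-distribˡ-sum)
  renaming (sum to ∑)

≡ᵇ-true : ∀ {m n} → m ≡ n → (m ≡ᵇ n) ≡ true
≡ᵇ-true {m} {n} = dec-true (m ℕ.≟ n)

≡ᵇ-false : ∀ {m n} → m ≢ n → (m ≡ᵇ n) ≡ false
≡ᵇ-false {m} {n} = dec-false (m ℕ.≟ n)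

ind : Bool → ℕ
ind b = if b then 1 else 0

if-then-0≡*ind : ∀ b n → (if b then n else 0) ≡ n *ℕ ind b
if-then-0≡*ind true  n = sym (ℕ.*-identityʳ n)
if-then-0≡*ind false n = sym (ℕ.*-zeroʳ n)

[ind[1≡L]+L*n]/L≡ind[L≡1]+n : ∀ L n → (ind (1 ≡ᵇ suc L) +ℕ suc L *ℕ n) / suc L ≡ ind (suc L ≡ᵇ 1) +ℕ n
[ind[1≡L]+L*n]/L≡ind[L≡1]+n zero    n = trans (n/1≡n _) (cong suc (ℕ.*-identityˡ n))
[ind[1≡L]+L*n]/L≡ind[L≡1]+n (suc L) n = trans (cong (_/ suc (suc L)) (ℕ.*-comm (suc (suc L)) n)) (m*n/n≡m n (suc (suc L)))

∑-mono-≤ : ∀ {n} {f g : Fin n → ℕ} → (∀ i → f i ≤ g i) → ∑ f ≤ ∑ g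
∑-mono-≤ {zero}  f≤g = z≤n
∑-mono-≤ {suc n} f≤g = ℕ.+-mono-≤ (f≤g zero) (∑-mono-≤ (λ i → f≤g (suc i)))

∑-const : ∀ n c → ∑[ i < n ] c ≡ n *ℕ c
∑-const zero    c = refl
∑-const (suc n) c = cong (c +ℕ_) (∑-const n c)

∑-zero : ∀ {n} {f : Fin n → ℕ} → (∀ i → f i ≡ 0) → ∑ f ≡ 0
∑-zero {n} f≡0 = trans (sum-cong-≗ f≡0) (sum-replicate-zero n)

∑-δ : ∀ {n} (f : Fin n → ℕ) j → (∀ i → i ≢ j → f i ≡ 0) → ∑ f ≡ f j
∑-δ {suc n} f j f≡0 = begin
  ∑ f                                  ≡⟨ sum-remove f ⟩
  f j +ℕ ∑[ i < n ] f (punchIn j i)    ≡⟨ cong (f j +ℕ_) (∑-zero (λ i → f≡0 _ (punchInᵢ≢i j i))) ⟩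
  f j +ℕ 0                             ≡⟨ ℕ.+-identityʳ (f j) ⟩
  f j                                  ∎
  where open ≡-Reasoning

∑-bounded-attained⇒≡ : ∀ {n} (f : Fin (suc n) → ℕ) l → (∀ i → f i ≤ l) →
                       ∑ f ≡ suc n *ℕ l → ∀ i → f i ≡ l
∑-bounded-attained⇒≡ {n} f l f≤l ∑f≡ i = ℕ.≤-antisym (f≤l i) (ℕ.+-cancelʳ-≤ (n *ℕ l) l (f i) l+nl≤fi+nl)
  where
  open ℕ.≤-Reasoning
  l+nl≤fi+nl : l +ℕ n *ℕ l ≤ f i +ℕ n *ℕ l
  l+nl≤fi+nl = begin
    l +ℕ n *ℕ l                    ≡⟨ sym ∑f≡ ⟩
    ∑ f                            ≡⟨ sum-remove f ⟩
    f i +ℕ ∑[ j < n ] f (punchIn i j)  ≤⟨ ℕ.+-monoʳ-≤ (f i) (∑-mono-≤ (λ j → f≤l (punchIn i j))) ⟩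
    f i +ℕ ∑[ j < n ] l            ≡⟨ cong (f i +ℕ_) (∑-const n l) ⟩
    f i +ℕ n *ℕ l                  ∎

sum-tabulate : ∀ {n} (f : Fin n → ℕ) → sum (tabulate f) ≡ ∑ f
sum-tabulate {zero}  f = refl
sum-tabulate {suc n} f = cong (f zero +ℕ_) (sum-tabulate (λ i → f (suc i)))

length-filterᵇ : ∀ {A : Set} (p : A → Bool) xs → length (filterᵇ p xs) ≡ sum (map (λ x → ind (p x)) xs)
length-filterᵇ p []       = refl
length-filterᵇ p (x ∷ xs) with p x
... | true  = cong suc (length-filterᵇ p xs)
... | false = length-filterᵇ p xs

sum-map-allFin : ∀ n (f : Fin n → ℕ) → sum (map f (allFin n)) ≡ ∑ f
sum-map-allFin n f = trans (cong sum (map-tabulate (λ i → i) f)) (sum-tabulate f)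

length-filterᵇ-map-allFin : ∀ {A : Set} n (h : Fin n → A) (p : A → Bool) →
                             length (filterᵇ p (map h (allFin n))) ≡ ∑[ i < n ] ind (p (h i))
length-filterᵇ-map-allFin n h p = begin
  length (filterᵇ p (map h (allFin n)))           ≡⟨ length-filterᵇ p (map h (allFin n)) ⟩
  sum (map p̂ (map h (allFin n)))                  ≡⟨ cong (sum ∘ map p̂) (map-tabulate (λ i → i) h) ⟩
  sum (map p̂ (tabulate h))                        ≡⟨ cong sum (map-tabulate h p̂) ⟩
  sum (tabulate (p̂ ∘ h))                          ≡⟨ sum-tabulate (p̂ ∘ h) ⟩
  ∑[ i < n ] ind (p (h i))                        ∎
  where
  open ≡-Reasoning
  p̂ = λ x → ind (p x)

module FiniteFieldProperties {q : ℕ} (F : FiniteField q) where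

  open FiniteField F
  open IsCommutativeRing isCommutativeRing
    using (+-identityˡ; +-identityʳ; *-identityˡ; *-identityʳ; *-assoc; *-comm;
           zeroˡ; zeroʳ; -‿inverseˡ; isCommutativeSemiring; *-isCommutativeMonoid)

  commutativeSemiring : CommutativeSemiring _ _
  commutativeSemiring = record { isCommutativeSemiring = isCommutativeSemiring }

  open import Algebra.Solver.Ring.NaturalCoefficients.Default commutativeSemiring
    using (solve; _:+_; _:*_; _:=_; con)

  to : Fin q → Carrier
  to = Inverse.to enum

  from : Carrier → Fin q
  from = Inverse.from enum

  to-from : ∀ x → to (from x) ≡ x
  to-from = Inverse.strictlyInverseˡ enum

  from-to : ∀ i → from (to i) ≡ i
  from-to = Inverse.strictlyInverseʳ enum

  from-injective : ∀ {x y} → from x ≡ from y → x ≡ y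
  from-injective {x} {y} e = trans (sym (to-from x)) (trans (cong to e) (to-from y))

  _≟_ : DecidableEquality Carrier
  x ≟ y = map′ from-injective (cong from) (from x ≟ᶠ from y)

  ==-true : ∀ {x y} → x ≡ y → (x == y) ≡ true
  ==-true {x} {y} = dec-true (x ≟ y)

  ==-false : ∀ {x y} → x ≢ y → (x == y) ≡ false
  ==-false {x} {y} = dec-false (x ≟ y)

  if-== : ∀ {A : Set} {x y} {a b : A} → x ≡ y → (if x == y then a else b) ≡ a
  if-== e rewrite ==-true e = refl

  if-≠ : ∀ {A : Set} {x y} {a b : A} → x ≢ y → (if x == y then a else b) ≡ b
  if-≠ ne rewrite ==-false ne = refl

  ^-distribˡ-+-* : ∀ x a b → x ^ (a +ℕ b) ≡ x ^ a * x ^ b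
  ^-distribˡ-+-* x zero    b = sym (*-identityˡ _)
  ^-distribˡ-+-* x (suc a) b = trans (cong (x *_) (^-distribˡ-+-* x a b)) (sym (*-assoc x _ _))

  1^n≡1 : ∀ n → 1# ^ n ≡ 1#
  1^n≡1 zero    = refl
  1^n≡1 (suc n) = trans (*-identityˡ _) (1^n≡1 n)

  ^-distribʳ-* : ∀ x y n → (x * y) ^ n ≡ x ^ n * y ^ n
  ^-distribʳ-* x y zero    = sym (*-identityˡ 1#)
  ^-distribʳ-* x y (suc n) = trans (cong ((x * y) *_) (^-distribʳ-* x y n))
    (solve 4 (λ a b c d → (a :* b) :* (c :* d) := (a :* c) :* (b :* d)) refl x y (x ^ n) (y ^ n))

  ^-*-assoc : ∀ x a b → (x ^ a) ^ b ≡ x ^ (a *ℕ b)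
  ^-*-assoc x zero    b = 1^n≡1 b
  ^-*-assoc x (suc a) b = begin
    (x * x ^ a) ^ b          ≡⟨ ^-distribʳ-* x (x ^ a) b ⟩
    x ^ b * (x ^ a) ^ b      ≡⟨ cong (x ^ b *_) (^-*-assoc x a b) ⟩
    x ^ b * x ^ (a *ℕ b)     ≡⟨ sym (^-distribˡ-+-* x b (a *ℕ b)) ⟩
    x ^ (b +ℕ a *ℕ b)        ∎
    where open ≡-Reasoning

  ^-comm-exponent : ∀ x a b → (x ^ a) ^ b ≡ (x ^ b) ^ a
  ^-comm-exponent x a b =
    trans (^-*-assoc x a b) (trans (cong (x ^_) (ℕ.*-comm a b)) (sym (^-*-assoc x b a)))

  ^≡1⇒^*≡1 : ∀ {x a} b → x ^ a ≡ 1# → x ^ (a *ℕ b) ≡ 1#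
  ^≡1⇒^*≡1 {x} {a} b xᵃ≡1 = trans (sym (^-*-assoc x a b)) (trans (cong (_^ b) xᵃ≡1) (1^n≡1 b))

  *-cancelʳ : ∀ {x y z} → z ≢ 0# → x * z ≡ y * z → x ≡ y
  *-cancelʳ {x} {y} {z} z≢0 e = begin
    x                ≡⟨ sym (*-identityʳ x) ⟩
    x * 1#           ≡⟨ cong (x *_) (sym (inverseʳ z z≢0)) ⟩
    x * (z * z ⁻¹)   ≡⟨ sym (*-assoc x z _) ⟩
    (x * z) * z ⁻¹   ≡⟨ cong (_* z ⁻¹) e ⟩
    (y * z) * z ⁻¹   ≡⟨ *-assoc y z _ ⟩
    y * (z * z ⁻¹)   ≡⟨ cong (y *_) (inverseʳ z z≢0) ⟩
    y * 1#           ≡⟨ *-identityʳ y ⟩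
    y                ∎
    where open ≡-Reasoning

  *-cancelˡ : ∀ {x y z} → z ≢ 0# → z * x ≡ z * y → x ≡ y
  *-cancelˡ {x} {y} {z} z≢0 e = *-cancelʳ z≢0 (trans (*-comm x z) (trans e (*-comm z y)))

  1≢0 : 1# ≢ 0#
  1≢0 e = 0≢1 (sym e)

  x*y≢0 : ∀ {x y} → x ≢ 0# → y ≢ 0# → x * y ≢ 0#
  x*y≢0 {x} {y} x≢0 y≢0 e = x≢0 (*-cancelʳ y≢0 (trans e (sym (zeroˡ y))))

  x^n≢0 : ∀ {x} n → x ≢ 0# → x ^ n ≢ 0#
  x^n≢0 zero    x≢0 = 1≢0
  x^n≢0 (suc n) x≢0 = x*y≢0 x≢0 (x^n≢0 n x≢0)

  inverse-unique : ∀ {x y} → x ≢ 0# → x * y ≡ 1# → y ≡ x ⁻¹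
  inverse-unique x≢0 e = *-cancelˡ x≢0 (trans e (sym (inverseʳ _ x≢0)))

  fieldSum : (Carrier → ℕ) → ℕ
  fieldSum g = ∑[ i < q ] g (to i)

  count : (Carrier → Bool) → ℕ
  count p = fieldSum (λ x → ind (p x))

  fieldSum-mono-≤ : ∀ {g h} → (∀ x → g x ≤ h x) → fieldSum g ≤ fieldSum h
  fieldSum-mono-≤ g≤h = ∑-mono-≤ (λ i → g≤h (to i))

  fieldSum-δ : ∀ c t → fieldSum (λ x → if x == c then t else 0) ≡ t
  fieldSum-δ c t = trans (∑-δ _ (from c) (λ i i≢c → if-≠ (λ e → i≢c (trans (sym (from-to i)) (cong from e)))))
                         (if-== (to-from c))

  fieldSum-comm : ∀ {n} (g : Carrier → Fin n → ℕ) →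
                  fieldSum (λ x → ∑[ k < n ] g x k) ≡ ∑[ k < n ] fieldSum (λ x → g x k)
  fieldSum-comm g = ∑-comm (λ i k → g (to i) k)

  fieldSum-+ : ∀ g h → fieldSum (λ x → g x +ℕ h x) ≡ fieldSum g +ℕ fieldSum h
  fieldSum-+ g h = ∑-distrib-+ (λ i → g (to i)) (λ i → h (to i))

  fieldSum-if : ∀ (p : Carrier → Bool) n → fieldSum (λ x → if p x then n else 0) ≡ n *ℕ count p
  fieldSum-if p n = trans (sum-cong-≗ (λ i → if-then-0≡*ind (p (to i)) n)) (sym (*-distribˡ-sum n (λ i → ind (p (to i)))))

  count-≢0 : fieldSum (λ x → if x == 0# then 0 else 1) ≡ q ∸ 1
  count-≢0 = trans (sym (ℕ.m+n∸n≡m _ 1)) (cong (_∸ 1) #≢0+1≡q)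
    where
    open ≡-Reasoning
    split : ∀ (b : Bool) → (if b then 0 else 1) +ℕ (if b then 1 else 0) ≡ 1
    split true  = refl
    split false = refl
    #≢0+1≡q : fieldSum (λ x → if x == 0# then 0 else 1) +ℕ 1 ≡ q
    #≢0+1≡q = begin
      fieldSum (λ x → if x == 0# then 0 else 1) +ℕ 1
        ≡⟨ cong (fieldSum (λ x → if x == 0# then 0 else 1) +ℕ_) (sym (fieldSum-δ 0# 1)) ⟩
      fieldSum (λ x → if x == 0# then 0 else 1) +ℕ fieldSum (λ x → if x == 0# then 1 else 0)
        ≡⟨ sym (fieldSum-+ (λ x → if x == 0# then 0 else 1) (λ x → if x == 0# then 1 else 0)) ⟩
      fieldSum (λ x → (if x == 0# then 0 else 1) +ℕ (if x == 0# then 1 else 0))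
        ≡⟨ sum-cong-≗ (λ i → split (to i == 0#)) ⟩
      ∑[ i < q ] 1
        ≡⟨ trans (∑-const q 1) (ℕ.*-identityʳ q) ⟩
      q ∎

  *-commutativeMonoid : CommutativeMonoid _ _
  *-commutativeMonoid = record { isCommutativeMonoid = *-isCommutativeMonoid }

  open import Algebra.Properties.CommutativeMonoid.Sum *-commutativeMonoid
    using () renaming (sum to ∏; sum-cong-≗ to ∏-cong; ∑-distrib-+ to ∏-distrib-*; sum-permute to ∏-permute)

  ∏-≢0 : ∀ {n} (f : Fin n → Carrier) → (∀ i → f i ≢ 0#) → ∏ f ≢ 0#
  ∏-≢0 {zero}  f f≢0 = 1≢0
  ∏-≢0 {suc n} f f≢0 = x*y≢0 (f≢0 zero) (∏-≢0 (λ i → f (suc i)) (λ i → f≢0 (suc i)))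

  ∏-if : ∀ a {n} (b : Fin n → Bool) → ∏ (λ i → if b i then 1# else a) ≡ a ^ ∑ (λ i → if b i then 0 else 1)
  ∏-if a {zero}  b = refl
  ∏-if a {suc n} b with b zero
  ... | true  = trans (*-identityˡ _) (∏-if a (λ i → b (suc i)))
  ... | false = cong (a *_) (∏-if a (λ i → b (suc i)))

  replace0by1 : Carrier → Carrier
  replace0by1 x = if x == 0# then 1# else x

  replace0by1-≢0 : ∀ x → replace0by1 x ≢ 0#
  replace0by1-≢0 x with x ≟ 0#
  ... | yes x≡0 = subst (_≢ 0#) (sym (if-== x≡0)) 1≢0
  ... | no  x≢0 = subst (_≢ 0#) (sym (if-≠ x≢0)) x≢0

  replace0by1-*ˡ : ∀ {a} → a ≢ 0# → ∀ x → replace0by1 (a * x) ≡ (if x == 0# then 1# else a) * replace0by1 x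
  replace0by1-*ˡ {a} a≢0 x with x ≟ 0#
  ... | yes x≡0 = begin
    replace0by1 (a * x)                             ≡⟨ if-== (trans (cong (a *_) x≡0) (zeroʳ a)) ⟩
    1#                                              ≡⟨ sym (*-identityˡ 1#) ⟩
    1# * 1#                                         ≡⟨ sym (cong₂ _*_ (if-== x≡0) (if-== x≡0)) ⟩
    (if x == 0# then 1# else a) * replace0by1 x     ∎
    where open ≡-Reasoning
  ... | no x≢0 = trans (if-≠ (x*y≢0 a≢0 x≢0)) (sym (cong₂ _*_ (if-≠ x≢0) (if-≠ x≢0)))

  *-permutation : ∀ {a} → a ≢ 0# → Permutation q q
  *-permutation {a} a≢0 = permutation (λ i → from (a * to i)) (λ i → from (a ⁻¹ * to i))
                                      (cancel (inverseʳ a a≢0)) (cancel (trans (*-comm _ a) (inverseʳ a a≢0)))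
    where
    cancel : ∀ {b c} → b * c ≡ 1# → ∀ i → from (b * to (from (c * to i))) ≡ i
    cancel {b} {c} bc≡1 i = begin
      from (b * to (from (c * to i)))  ≡⟨ cong (λ z → from (b * z)) (to-from _) ⟩
      from (b * (c * to i))            ≡⟨ cong from (sym (*-assoc b c (to i))) ⟩
      from ((b * c) * to i)            ≡⟨ cong (λ z → from (z * to i)) bc≡1 ⟩
      from (1# * to i)                 ≡⟨ cong from (*-identityˡ (to i)) ⟩
      from (to i)                      ≡⟨ from-to i ⟩
      i                                ∎
      where open ≡-Reasoning

  -- Multiplication by a permutes the field, so ∏ replace0by1 (a x) = ∏ replace0by1 x; the left side
  -- carries an extra factor a for every nonzero x.
  fermat : ∀ a → a ≢ 0# → a ^ (q ∸ 1) ≡ 1#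
  fermat a a≢0 = begin
    a ^ (q ∸ 1)                                     ≡⟨ cong (a ^_) (sym count-≢0) ⟩
    a ^ fieldSum (λ x → if x == 0# then 0 else 1)   ≡⟨ sym (∏-if a (λ i → to i == 0#)) ⟩
    ∏ (λ i → h (to i))                              ≡⟨ *-cancelʳ (∏-≢0 (g ∘ to) (replace0by1-≢0 ∘ to)) ∏h∏g≡∏g ⟩
    1#                                              ∎
    where
    open ≡-Reasoning
    g h : Carrier → Carrier
    g = replace0by1
    h x = if x == 0# then 1# else a

    ∏h∏g≡∏g : ∏ (h ∘ to) * ∏ (g ∘ to) ≡ 1# * ∏ (g ∘ to)
    ∏h∏g≡∏g = begin
      ∏ (h ∘ to) * ∏ (g ∘ to)             ≡⟨ sym (∏-distrib-* (h ∘ to) (g ∘ to)) ⟩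
      ∏ (λ i → h (to i) * g (to i))       ≡⟨ sym (∏-cong (λ i → trans (cong g (to-from _))
                                                                      (replace0by1-*ˡ a≢0 (to i)))) ⟩
      ∏ (λ i → g (to (from (a * to i))))  ≡⟨ sym (∏-permute (g ∘ to) (*-permutation a≢0)) ⟩
      ∏ (g ∘ to)                          ≡⟨ sym (*-identityˡ _) ⟩
      1# * ∏ (g ∘ to)                     ∎

  ∑-select : ∀ {n} {t : Fin n → Carrier} → Injective _≡_ _≡_ t → (s : Fin n → ℕ) →
             ∀ {y} k → y ≡ t k → ∑[ i < n ] (if y == t i then s i else 0) ≡ s k
  ∑-select t-inj s k y≡tk =
    trans (∑-δ _ k (λ i i≢k → if-≠ (λ y≡ti → i≢k (t-inj (trans (sym y≡ti) y≡tk))))) (if-== y≡tk)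

  ∑-select-∉ : ∀ {n} (t : Fin n → Carrier) (s : Fin n → ℕ) →
               ∀ {y} → (∀ i → y ≢ t i) → ∑[ i < n ] (if y == t i then s i else 0) ≡ 0
  ∑-select-∉ t s y∉t = ∑-zero (λ i → if-≠ (y∉t i))

  count-≤⇒image-exhausts : ∀ {n} (p : Carrier → Bool) → count p ≤ n →
                           (t : Fin n → Carrier) → Injective _≡_ _≡_ t → (∀ i → p (t i) ≡ true) →
                           ∀ {w} → p w ≡ true → ∃[ k ] w ≡ t k
  count-≤⇒image-exhausts {n} p #p≤n t t-inj pt {w} pw with any? (λ k → w ≟ t k)
  ... | yes w∈t = w∈t
  ... | no  w∉t = contradiction #p≤n (ℕ.<⇒≱ n<#p)
    where
    hit : Carrier → ℕ
    hit x = (if x == w then 1 else 0) +ℕ ∑[ k < n ] (if x == t k then 1 else 0)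

    hit≤p : ∀ x → hit x ≤ ind (p x)
    hit≤p x with x ≟ w | any? (λ k → x ≟ t k)
    ... | yes refl | _ = ℕ.≤-reflexive (trans (cong₂ _+ℕ_ (if-== refl)
                          (∑-select-∉ t (λ _ → 1) (λ k w≡tk → w∉t (k , w≡tk)))) (cong ind (sym pw)))
    ... | no x≢w | yes (k , refl) = ℕ.≤-reflexive (trans (cong₂ _+ℕ_ (if-≠ x≢w) (∑-select t-inj (λ _ → 1) k refl))
                                                         (cong ind (sym (pt k))))
    ... | no x≢w | no x∉t = ℕ.≤-trans (ℕ.≤-reflexive (cong₂ _+ℕ_ (if-≠ x≢w)
                              (∑-select-∉ t (λ _ → 1) (λ k x≡tk → x∉t (k , x≡tk))))) z≤n

    n<#p : n < count p
    n<#p = begin-strict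
      n                                      <⟨ ℕ.n<1+n n ⟩
      1 +ℕ n                                 ≡⟨ cong₂ _+ℕ_ (sym (fieldSum-δ w 1)) (sym #image) ⟩
      fieldSum (λ x → if x == w then 1 else 0) +ℕ fieldSum (λ x → ∑[ k < n ] (if x == t k then 1 else 0))
                                             ≡⟨ sym (fieldSum-+ (λ x → if x == w then 1 else 0)
                                                                (λ x → ∑[ k < n ] (if x == t k then 1 else 0))) ⟩
      fieldSum hit                           ≤⟨ fieldSum-mono-≤ hit≤p ⟩
      count p                                ∎
      where
      open ℕ.≤-Reasoning
      #image : fieldSum (λ x → ∑[ k < n ] (if x == t k then 1 else 0)) ≡ n
      #image = trans (fieldSum-comm (λ x k → if x == t k then 1 else 0))
                     (trans (sum-cong-≗ (λ k → fieldSum-δ (t k) 1)) (trans (∑-const n 1) (ℕ.*-identityʳ n)))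

  ==⇒≡ : ∀ {x y} → (x == y) ≡ true → x ≡ y
  ==⇒≡ {x} {y} e with x ≟ y
  ... | yes x≡y = x≡y
  ... | no  x≢y = contradiction (trans (sym e) (==-false x≢y)) λ ()

  count-mono-≤ : ∀ {p p' : Carrier → Bool} → (∀ x → p x ≡ true → p' x ≡ true) → count p ≤ count p'
  count-mono-≤ {p} {p'} p⇒p' = fieldSum-mono-≤ pointwise
    where
    pointwise : ∀ x → ind (p x) ≤ ind (p' x)
    pointwise x with p x in px
    ... | true  rewrite p⇒p' x px = ℕ.≤-refl
    ... | false = z≤n

  count-≤-1+ : ∀ a {p p' : Carrier → Bool} → (∀ x → x ≢ a → p x ≡ true → p' x ≡ true) →
               count p ≤ 1 +ℕ count p'
  count-≤-1+ a {p} {p'} p⇒p' = begin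
    count p                                                    ≤⟨ fieldSum-mono-≤ pointwise ⟩
    fieldSum (λ x → δₐ x +ℕ ind (p' x))                        ≡⟨ fieldSum-+ δₐ (λ x → ind (p' x)) ⟩
    fieldSum δₐ +ℕ count p'                                    ≡⟨ cong (_+ℕ count p') (fieldSum-δ a 1) ⟩
    1 +ℕ count p'                                              ∎
    where
    open ℕ.≤-Reasoning
    δₐ : Carrier → ℕ
    δₐ x = if x == a then 1 else 0
    pointwise : ∀ x → ind (p x) ≤ δₐ x +ℕ ind (p' x)
    pointwise x with x ≟ a | p x in px
    ... | yes x≡a | true  rewrite ==-true x≡a = s≤s z≤n
    ... | yes _   | false = z≤n
    ... | no x≢a  | true  rewrite ==-false x≢a | p⇒p' x x≢a px = ℕ.≤-refl
    ... | no _    | false = z≤n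

  evalPoly-0 : ∀ n y → evalPoly {n} (λ _ → 0#) y ≡ 0#
  evalPoly-0 zero    y = refl
  evalPoly-0 (suc n) y = trans (cong (λ t → 0# + y * t) (evalPoly-0 n y))
                               (trans (+-identityˡ _) (zeroʳ y))

  evalLead : ∀ n → (Fin n → Carrier) → Carrier → Carrier → Carrier
  evalLead n p c y = evalPoly p y + c * y ^ n

  synthDiv : Carrier → Carrier → ∀ n → (Fin (suc n) → Carrier) → Fin n → Carrier
  synthDiv a c (suc n) p zero    = evalLead (suc n) (tail p) c a
  synthDiv a c (suc n) p (suc i) = synthDiv a c n (tail p) i

  -- P y − P a = (y − a) · Q y, where Q is the quotient of P by X − a, rearranged to avoid subtraction.
  evalLead-synthDiv : ∀ a c n p y → let Q = evalLead n (synthDiv a c n p) c y in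
                      evalLead (suc n) p c y + a * Q ≡ y * Q + evalLead (suc n) p c a
  evalLead-synthDiv a c zero p y =
    solve 4 (λ p₀ y c a → ((p₀ :+ y :* con 0) :+ c :* (y :* con 1)) :+ a :* (con 0 :+ c :* con 1)
                        := y :* (con 0 :+ c :* con 1) :+ ((p₀ :+ a :* con 0) :+ c :* (a :* con 1)))
          refl (p zero) y c a
  evalLead-synthDiv a c (suc n) p y = begin
    ((p₀ + y * P₁y) + c * (y * (y * yⁿ))) + a * (((P₁a + c * aⁿ⁺¹) + y * Q₁y) + c * (y * yⁿ))
      ≡⟨ solve 9 (λ p₀ y P₁y c yⁿ a P₁a aⁿ⁺¹ Q₁y →
            ((p₀ :+ y :* P₁y) :+ c :* (y :* (y :* yⁿ))) :+ a :* (((P₁a :+ c :* aⁿ⁺¹) :+ y :* Q₁y) :+ c :* (y :* yⁿ))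
            := (p₀ :+ a :* (P₁a :+ c :* aⁿ⁺¹)) :+ y :* ((P₁y :+ c :* (y :* yⁿ)) :+ a :* (Q₁y :+ c :* yⁿ)))
          refl p₀ y P₁y c yⁿ a P₁a aⁿ⁺¹ Q₁y ⟩
    (p₀ + a * (P₁a + c * aⁿ⁺¹)) + y * ((P₁y + c * (y * yⁿ)) + a * (Q₁y + c * yⁿ))
      ≡⟨ cong (λ t → (p₀ + a * (P₁a + c * aⁿ⁺¹)) + y * t) (evalLead-synthDiv a c n (tail p) y) ⟩
    (p₀ + a * (P₁a + c * aⁿ⁺¹)) + y * (y * (Q₁y + c * yⁿ) + (P₁a + c * aⁿ⁺¹))
      ≡⟨ solve 8 (λ p₀ y c yⁿ a P₁a aⁿ⁺¹ Q₁y →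
            (p₀ :+ a :* (P₁a :+ c :* aⁿ⁺¹)) :+ y :* (y :* (Q₁y :+ c :* yⁿ) :+ (P₁a :+ c :* aⁿ⁺¹))
            := y :* (((P₁a :+ c :* aⁿ⁺¹) :+ y :* Q₁y) :+ c :* (y :* yⁿ)) :+ ((p₀ :+ a :* P₁a) :+ c :* (a :* aⁿ⁺¹)))
          refl p₀ y c yⁿ a P₁a aⁿ⁺¹ Q₁y ⟩
    y * (((P₁a + c * aⁿ⁺¹) + y * Q₁y) + c * (y * yⁿ)) + ((p₀ + a * P₁a) + c * (a * aⁿ⁺¹)) ∎
    where
    open ≡-Reasoning
    p₀ = p zero
    P₁y = evalPoly (tail p) y
    P₁a = evalPoly (tail p) a
    aⁿ⁺¹ = a ^ suc n
    yⁿ = y ^ n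
    Q₁y = evalPoly (synthDiv a c n (tail p)) y

  evalLead-root⇒quotient-root : ∀ a c n p x → evalLead (suc n) p c a ≡ 0# → evalLead (suc n) p c x ≡ 0# →
                                x ≢ a → evalLead n (synthDiv a c n p) c x ≡ 0#
  evalLead-root⇒quotient-root a c n p x Pa≡0 Px≡0 x≢a with evalLead n (synthDiv a c n p) c x ≟ 0#
  ... | yes Qx≡0 = Qx≡0
  ... | no  Qx≢0 = contradiction (sym (*-cancelʳ Qx≢0 aQ≡xQ)) x≢a
    where
    open ≡-Reasoning
    Qx = evalLead n (synthDiv a c n p) c x
    aQ≡xQ : a * Qx ≡ x * Qx
    aQ≡xQ = begin
      a * Qx                              ≡⟨ sym (+-identityˡ _) ⟩
      0# + a * Qx                         ≡⟨ cong (_+ a * Qx) (sym Px≡0) ⟩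
      evalLead (suc n) p c x + a * Qx     ≡⟨ evalLead-synthDiv a c n p x ⟩
      x * Qx + evalLead (suc n) p c a     ≡⟨ cong (x * Qx +_) Pa≡0 ⟩
      x * Qx + 0#                         ≡⟨ +-identityʳ _ ⟩
      x * Qx                              ∎

  #roots≤degree : ∀ n p c → c ≢ 0# → count (λ y → evalLead n p c y == 0#) ≤ n
  #roots≤degree zero p c c≢0 = ℕ.≤-reflexive (∑-zero {q} (λ i → cong ind (==-false (λ e →
    c≢0 (trans (sym (*-identityʳ c)) (trans (sym (+-identityˡ _)) e))))))
  #roots≤degree (suc n) p c c≢0 with any? (λ i → evalLead (suc n) p c (to i) ≟ 0#)
  ... | no noRoot = ℕ.≤-trans (ℕ.≤-reflexive (∑-zero {q} (λ i → cong ind (==-false (λ e → noRoot (i , e)))))) z≤n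
  ... | yes (i , Pa≡0) = ℕ.≤-trans
          (count-≤-1+ (to i) (λ x x≢a Px≡0 →
             ==-true (evalLead-root⇒quotient-root (to i) c n p x Pa≡0 (==⇒≡ Px≡0) x≢a)))
          (s≤s (#roots≤degree n (synthDiv (to i) c n p) c c≢0))

  binomial : ∀ k → Carrier → Fin (suc k) → Carrier
  binomial k c zero    = - c
  binomial k c (suc i) = 0#

  #roots-binomial : ∀ k c → count (λ y → (y ^ suc k) == c) ≤ suc k
  #roots-binomial k c = ℕ.≤-trans (count-mono-≤ (λ y yᵏ⁺¹≡c → ==-true (root y (==⇒≡ yᵏ⁺¹≡c))))
                                  (#roots≤degree (suc k) (binomial k c) 1# 1≢0)
    where
    root : ∀ y → y ^ suc k ≡ c → evalLead (suc k) (binomial k c) 1# y ≡ 0#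
    root y yᵏ⁺¹≡c = begin
      (- c + y * evalPoly {k} (λ _ → 0#) y) + 1# * y ^ suc k
        ≡⟨ cong₂ (λ s t → (- c + y * s) + t) (evalPoly-0 k y) (*-identityˡ _) ⟩
      (- c + y * 0#) + y ^ suc k                              ≡⟨ cong₂ (λ s t → (- c + s) + t) (zeroʳ y) yᵏ⁺¹≡c ⟩
      (- c + 0#) + c                                          ≡⟨ cong (_+ c) (+-identityʳ (- c)) ⟩
      - c + c                                                 ≡⟨ -‿inverseˡ c ⟩
      0#                                                      ∎
      where open ≡-Reasoning

  evalPoly-+ : ∀ n (a b : Fin n → Carrier) z → evalPoly (zipWith _+_ a b) z ≡ evalPoly a z + evalPoly b z
  evalPoly-+ zero    a b z = sym (+-identityˡ 0#)
  evalPoly-+ (suc n) a b z =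
    trans (cong (λ t → (head a + head b) + z * t) (evalPoly-+ n (tail a) (tail b) z))
          (solve 5 (λ a₀ b₀ z A B → (a₀ :+ b₀) :+ z :* (A :+ B) := (a₀ :+ z :* A) :+ (b₀ :+ z :* B))
                 refl (head a) (head b) z (evalPoly (tail a) z) (evalPoly (tail b) z))

  evalPoly-* : ∀ n s (b : Fin n → Carrier) z → evalPoly (mapᵛ (s *_) b) z ≡ s * evalPoly b z
  evalPoly-* zero    s b z = sym (zeroʳ s)
  evalPoly-* (suc n) s b z =
    trans (cong (λ t → s * head b + z * t) (evalPoly-* n s (tail b) z))
          (solve 4 (λ s b₀ z B → s :* b₀ :+ z :* (s :* B) := s :* (b₀ :+ z :* B))
                 refl s (head b) z (evalPoly (tail b) z))

  evalPoly-init-last : ∀ n (c : Fin (suc n) → Carrier) z →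
                       evalPoly c z ≡ evalPoly (init c) z + z ^ n * last c
  evalPoly-init-last zero    c z =
    solve 2 (λ c₀ z → c₀ :+ z :* con 0 := con 0 :+ con 1 :* c₀) refl (head c) z
  evalPoly-init-last (suc n) c z =
    trans (cong (λ t → head c + z * t) (evalPoly-init-last n (tail c) z))
          (solve 5 (λ c₀ z I zⁿ cₗ → c₀ :+ z :* (I :+ zⁿ :* cₗ) := (c₀ :+ z :* I) :+ (z :* zⁿ) :* cₗ)
                 refl (head c) z (evalPoly (init (tail c)) z) (z ^ n) (last c))

  -- Arithmetic modulo X^(n+1) − 1 on coefficient vectors: rotate c is X · c, mulMod a b is a · b
  -- (Horner in a) and powMod e b is b^e.
  rotate : ∀ {n} → (Fin (suc n) → Carrier) → Fin (suc n) → Carrier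
  rotate c = last c ∷ᵛ init c

  evalPoly-rotate : ∀ n (c : Fin (suc n) → Carrier) z → z ^ suc n ≡ 1# →
                    evalPoly (rotate c) z ≡ z * evalPoly c z
  evalPoly-rotate n c z zⁿ⁺¹≡1 = sym (begin
    z * evalPoly c z                                ≡⟨ cong (z *_) (evalPoly-init-last n c z) ⟩
    z * (evalPoly (init c) z + z ^ n * last c)      ≡⟨ solve 4 (λ z I zⁿ cₗ → z :* (I :+ zⁿ :* cₗ) := (z :* zⁿ) :* cₗ :+ z :* I)
                                                             refl z (evalPoly (init c) z) (z ^ n) (last c) ⟩
    z ^ suc n * last c + z * evalPoly (init c) z    ≡⟨ cong (λ t → t * last c + z * evalPoly (init c) z) zⁿ⁺¹≡1 ⟩
    1# * last c + z * evalPoly (init c) z           ≡⟨ cong (_+ z * evalPoly (init c) z) (*-identityˡ (last c)) ⟩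
    last c + z * evalPoly (init c) z                ∎)
    where open ≡-Reasoning

  mulMod : ∀ {k n} → (Fin k → Carrier) → (Fin (suc n) → Carrier) → Fin (suc n) → Carrier
  mulMod {zero}  a b = replicate _ 0#
  mulMod {suc k} a b = zipWith _+_ (mapᵛ (head a *_) b) (rotate (mulMod (tail a) b))

  evalPoly-mulMod : ∀ n k (a : Fin k → Carrier) (b : Fin (suc n) → Carrier) z → z ^ suc n ≡ 1# →
                    evalPoly (mulMod a b) z ≡ evalPoly a z * evalPoly b z
  evalPoly-mulMod n zero    a b z zⁿ⁺¹≡1 = trans (evalPoly-0 (suc n) z) (sym (zeroˡ _))
  evalPoly-mulMod n (suc k) a b z zⁿ⁺¹≡1 = begin
    evalPoly (zipWith _+_ (mapᵛ (head a *_) b) (rotate (mulMod (tail a) b))) z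
      ≡⟨ evalPoly-+ (suc n) (mapᵛ (head a *_) b) (rotate (mulMod (tail a) b)) z ⟩
    evalPoly (mapᵛ (head a *_) b) z + evalPoly (rotate (mulMod (tail a) b)) z
      ≡⟨ cong₂ _+_ (evalPoly-* (suc n) (head a) b z) (evalPoly-rotate n (mulMod (tail a) b) z zⁿ⁺¹≡1) ⟩
    head a * evalPoly b z + z * evalPoly (mulMod (tail a) b) z
      ≡⟨ cong (λ t → head a * evalPoly b z + z * t) (evalPoly-mulMod n k (tail a) b z zⁿ⁺¹≡1) ⟩
    head a * evalPoly b z + z * (evalPoly (tail a) z * evalPoly b z)
      ≡⟨ solve 4 (λ a₀ B z A → a₀ :* B :+ z :* (A :* B) := (a₀ :+ z :* A) :* B)
               refl (head a) (evalPoly b z) z (evalPoly (tail a) z) ⟩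
    (head a + z * evalPoly (tail a) z) * evalPoly b z ∎
    where open ≡-Reasoning

  powMod : ∀ {n} → ℕ → (Fin (suc n) → Carrier) → Fin (suc n) → Carrier
  powMod zero    b = 1# ∷ᵛ replicate _ 0#
  powMod (suc e) b = mulMod b (powMod e b)

  evalPoly-powMod : ∀ n e (b : Fin (suc n) → Carrier) z → z ^ suc n ≡ 1# →
                    evalPoly (powMod e b) z ≡ evalPoly b z ^ e
  evalPoly-powMod n zero    b z zⁿ⁺¹≡1 =
    trans (cong (λ t → 1# + z * t) (evalPoly-0 n z)) (trans (cong (1# +_) (zeroʳ z)) (+-identityʳ 1#))
  evalPoly-powMod n (suc e) b z zⁿ⁺¹≡1 =
    trans (evalPoly-mulMod n (suc n) b (powMod e b) z zⁿ⁺¹≡1)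
          (cong (evalPoly b z *_) (evalPoly-powMod n e b z zⁿ⁺¹≡1))

  HasOrder⇒≢0 : ∀ {w o} → HasOrder w o → w ≢ 0#
  HasOrder⇒≢0 {w} {suc o} (_ , wᵒ⁺¹≡1 , _) w≡0 =
    0≢1 (trans (sym (zeroˡ (w ^ o))) (trans (cong (_* w ^ o) (sym w≡0)) wᵒ⁺¹≡1))

  HasOrder⇒^≡1 : ∀ {w o} → HasOrder w o → ∀ {n} → o ∣ n → w ^ n ≡ 1#
  HasOrder⇒^≡1 {w} {o} (_ , wᵒ≡1 , _) (divides a refl) =
    trans (cong (w ^_) (ℕ.*-comm a o)) (^≡1⇒^*≡1 {w} {o} a wᵒ≡1)

  ^-distinct-<-order : ∀ {w o} → HasOrder w o → ∀ {a b} → a < b → b < o → w ^ a ≢ w ^ b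
  ^-distinct-<-order {w} ord@(_ , _ , minimal) {a} {b} a<b b<o wᵃ≡wᵇ =
    minimal (b ∸ a) (ℕ.m<n⇒0<n∸m a<b) (ℕ.≤-<-trans (ℕ.m∸n≤m b a) b<o)
            (sym (*-cancelˡ (x^n≢0 a (HasOrder⇒≢0 ord)) (begin
              w ^ a * 1#              ≡⟨ *-identityʳ _ ⟩
              w ^ a                   ≡⟨ wᵃ≡wᵇ ⟩
              w ^ b                   ≡⟨ cong (w ^_) (sym (ℕ.m+[n∸m]≡n (ℕ.<⇒≤ a<b))) ⟩
              w ^ (a +ℕ (b ∸ a))      ≡⟨ ^-distribˡ-+-* w a (b ∸ a) ⟩
              w ^ a * w ^ (b ∸ a)     ∎)))
    where open ≡-Reasoning

  ^-injective-<-order : ∀ {w o} → HasOrder w o → ∀ {a b} → a < o → b < o → w ^ a ≡ w ^ b → a ≡ b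
  ^-injective-<-order ord {a} {b} a<o b<o wᵃ≡wᵇ with ℕ.<-cmp a b
  ... | tri< a<b _ _ = contradiction wᵃ≡wᵇ (^-distinct-<-order ord a<b b<o)
  ... | tri≈ _ a≡b _ = a≡b
  ... | tri> _ _ b<a = contradiction (sym wᵃ≡wᵇ) (^-distinct-<-order ord b<a a<o)

  HasPeriod : (Carrier → Carrier) → Carrier → ℕ → Set
  HasPeriod f x o = 1 ≤ o × iter f o x ≡ x × (∀ j → 1 ≤ j → j < o → iter f j x ≢ x)

  noReturn-true : ∀ f x n → (∀ j → 1 ≤ j → j ≤ n → iter f j x ≢ x) → noReturn f n x ≡ true
  noReturn-true f x zero    _      = refl
  noReturn-true f x (suc n) return rewrite ==-false (return (suc n) (s≤s z≤n) ℕ.≤-refl) =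
    noReturn-true f x n (λ j 1≤j j≤n → return j 1≤j (ℕ.m≤n⇒m≤1+n j≤n))

  noReturn-false : ∀ f x n {j} → 1 ≤ j → j ≤ n → iter f j x ≡ x → noReturn f n x ≡ false
  noReturn-false f x zero    1≤j j≤0 _ = contradiction (ℕ.≤-trans 1≤j j≤0) λ ()
  noReturn-false f x (suc n) {j} 1≤j j≤1+n fʲx≡x with ℕ.m≤n⇒m<n∨m≡n j≤1+n
  ... | inj₂ refl rewrite ==-true fʲx≡x = refl
  ... | inj₁ (s≤s j≤n) rewrite noReturn-false f x n 1≤j j≤n fʲx≡x = ∧-zeroʳ _

  onCycleOfLength-period : ∀ {f x o} → HasPeriod f x o → ∀ L → onCycleOfLength f L x ≡ (o ≡ᵇ L)
  onCycleOfLength-period {o = suc o} _ zero = refl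
  onCycleOfLength-period {f} {x} {o} (1≤o , fᵒx≡x , minimal) (suc L) with ℕ.<-cmp o (suc L)
  ... | tri< o<L _ _ rewrite noReturn-false f x L 1≤o (ℕ.≤-pred o<L) fᵒx≡x | ≡ᵇ-false (ℕ.<⇒≢ o<L) = ∧-zeroʳ _
  ... | tri≈ _ refl _ rewrite ==-true fᵒx≡x | ≡ᵇ-true {o} refl =
    noReturn-true f x L (λ j 1≤j j≤L → minimal j 1≤j (s≤s j≤L))
  ... | tri> _ _ L<o rewrite ==-false (minimal (suc L) (s≤s z≤n) L<o) | ≡ᵇ-false (ℕ.>⇒≢ L<o) = refl

  fixed⇒period-1 : ∀ {f x} → f x ≡ x → HasPeriod f x 1
  fixed⇒period-1 fx≡x = ℕ.≤-refl , fx≡x , λ { j 1≤j (s≤s j≤0) → contradiction (ℕ.≤-trans 1≤j j≤0) λ () }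

  iter-scaling⇒period : ∀ {f x w o} → x ≢ 0# → HasOrder w o → (∀ j → iter f j x ≡ x * w ^ j) → HasPeriod f x o
  iter-scaling⇒period {f} {x} {w} {o} x≢0 (1≤o , wᵒ≡1 , minimal) fʲx≡xwʲ =
    1≤o , trans (fʲx≡xwʲ o) (trans (cong (x *_) wᵒ≡1) (*-identityʳ x)) ,
    λ j 1≤j j<o fʲx≡x → minimal j 1≤j j<o (*-cancelˡ x≢0 (trans (sym (fʲx≡xwʲ j)) (trans fʲx≡x (sym (*-identityʳ x)))))

module PermutationPolynomial {q : ℕ} (F : FiniteField q) where

  open FiniteField F
  open FiniteFieldProperties F
  open IsCommutativeRing isCommutativeRing using (*-identityʳ; *-assoc; *-comm; zeroˡ)

  module Properties
    (r' : ℕ) (ζ : Carrier) (ordζ : HasOrder ζ (suc r'))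
    (m d : ℕ) (1≤m : 1 ≤ m) (1≤d : 1 ≤ d) (q-1≡md : q ∸ 1 ≡ m *ℕ d) (r∣d : suc r' ∣ d)
    (u : Fin (suc r') → Carrier) (ms : Fin (suc r') → ℕ)
    (ord-u : ∀ i → HasOrder (u i) (ms i)) (ms∣m : ∀ i → ms i ∣ m)
    (G : Fin (suc r') → Carrier) (G[ζᵏ]≡u : ∀ k → evalPoly G (ζ ^ toℕ k) ≡ u k)
    where

    r : ℕ
    r = suc r'

    ℓ : ℕ
    ℓ = (q ∸ 1) div r

    f : Carrier → Carrier
    f x = x * evalPoly G (x ^ ℓ)

    open _∣_ r∣d using () renaming (quotient to b; equality to d≡b*r)

    ℓ≡m*b : ℓ ≡ m *ℕ b
    ℓ≡m*b = begin
      (q ∸ 1) / r       ≡⟨ cong (_/ r) (trans q-1≡md (cong (m *ℕ_) d≡b*r)) ⟩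
      m *ℕ (b *ℕ r) / r ≡⟨ cong (_/ r) (sym (ℕ.*-assoc m b r)) ⟩
      m *ℕ b *ℕ r / r   ≡⟨ m*n/n≡m (m *ℕ b) r ⟩
      m *ℕ b            ∎
      where open ≡-Reasoning

    ℓ*r≡q-1 : ℓ *ℕ r ≡ q ∸ 1
    ℓ*r≡q-1 = begin
      ℓ *ℕ r            ≡⟨ cong (_*ℕ r) ℓ≡m*b ⟩
      m *ℕ b *ℕ r       ≡⟨ ℕ.*-assoc m b r ⟩
      m *ℕ (b *ℕ r)     ≡⟨ cong (m *ℕ_) (sym d≡b*r) ⟩
      m *ℕ d            ≡⟨ sym q-1≡md ⟩
      q ∸ 1             ∎
      where open ≡-Reasoning

    1+[ℓ-1]≡ℓ : suc (ℓ ∸ 1) ≡ ℓ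
    1+[ℓ-1]≡ℓ = ℕ.m+[n∸m]≡n (subst (1 ≤_) (sym ℓ≡m*b) (ℕ.*-mono-≤ 1≤m 1≤b))
      where
      1≤b : 1 ≤ b
      1≤b = ℕ.n≢0⇒n>0 (λ b≡0 → ℕ.<⇒≢ 1≤d (sym (trans d≡b*r (cong (_*ℕ r) b≡0))))

    Z : Fin r → Carrier
    Z k = ζ ^ toℕ k

    Z-injective : Injective _≡_ _≡_ Z
    Z-injective {i} {j} = toℕ-injective ∘ ^-injective-<-order ordζ (toℕ<n i) (toℕ<n j)

    Z[k]^r≡1 : ∀ k → Z k ^ r ≡ 1#
    Z[k]^r≡1 k = trans (^-*-assoc ζ (toℕ k) r) (HasOrder⇒^≡1 ordζ (n∣m*n (toℕ k)))

    x^ℓ∈⟨ζ⟩ : ∀ {x} → x ≢ 0# → ∃[ k ] x ^ ℓ ≡ Z k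
    x^ℓ∈⟨ζ⟩ {x} x≢0 = count-≤⇒image-exhausts (λ y → (y ^ r) == 1#) (#roots-binomial r' 1#)
      Z Z-injective (λ k → ==-true (Z[k]^r≡1 k))
      (==-true (trans (^-*-assoc x ℓ r) (trans (cong (x ^_) ℓ*r≡q-1) (fermat x x≢0))))

    0^ℓ∉⟨ζ⟩ : ∀ k → 0# ^ ℓ ≢ Z k
    0^ℓ∉⟨ζ⟩ k 0^ℓ≡Zk = x^n≢0 (toℕ k) (HasOrder⇒≢0 ordζ) (trans (sym 0^ℓ≡Zk) 0^ℓ≡0)
      where
      0^ℓ≡0 : 0# ^ ℓ ≡ 0#
      0^ℓ≡0 = trans (cong (0# ^_) (sym 1+[ℓ-1]≡ℓ)) (zeroˡ _)

    u^ℓ≡1 : ∀ k → u k ^ ℓ ≡ 1#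
    u^ℓ≡1 k = HasOrder⇒^≡1 (ord-u k) (subst (ms k ∣_) (sym ℓ≡m*b) (∣-trans (ms∣m k) (m∣m*n b)))

    ^ℓ-*-invariant : ∀ y {w} → w ^ ℓ ≡ 1# → (y * w) ^ ℓ ≡ y ^ ℓ
    ^ℓ-*-invariant y {w} wˡ≡1 = trans (^-distribʳ-* y w ℓ) (trans (cong (y ^ ℓ *_) wˡ≡1) (*-identityʳ _))

    [u^j]^ℓ≡1 : ∀ k j → (u k ^ j) ^ ℓ ≡ 1#
    [u^j]^ℓ≡1 k j = trans (^-comm-exponent (u k) j ℓ) (trans (cong (_^ j) (u^ℓ≡1 k)) (1^n≡1 j))

    f-on-fiber : ∀ {y} k → y ^ ℓ ≡ Z k → f y ≡ y * u k
    f-on-fiber {y} k y^ℓ≡Zk = cong (y *_) (trans (cong (evalPoly G) y^ℓ≡Zk) (G[ζᵏ]≡u k))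

    iter-f-on-fiber : ∀ {x} k → x ^ ℓ ≡ Z k → ∀ j → iter f j x ≡ x * u k ^ j
    iter-f-on-fiber {x} k x^ℓ≡Zk zero    = sym (*-identityʳ x)
    iter-f-on-fiber {x} k x^ℓ≡Zk (suc j) = begin
      f (iter f j x)       ≡⟨ cong f (iter-f-on-fiber k x^ℓ≡Zk j) ⟩
      f (x * u k ^ j)      ≡⟨ f-on-fiber k (trans (^ℓ-*-invariant x ([u^j]^ℓ≡1 k j)) x^ℓ≡Zk) ⟩
      x * u k ^ j * u k    ≡⟨ *-assoc x (u k ^ j) (u k) ⟩
      x * (u k ^ j * u k)  ≡⟨ cong (x *_) (*-comm (u k ^ j) (u k)) ⟩
      x * u k ^ suc j      ∎
      where open ≡-Reasoning

    f0≡0 : f 0# ≡ 0#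
    f0≡0 = zeroˡ _

    fiber : Fin r → ℕ
    fiber k = count (λ x → (x ^ ℓ) == Z k)

    fiber≤ℓ : ∀ k → fiber k ≤ ℓ
    fiber≤ℓ k = subst (λ n → count (λ x → (x ^ n) == Z k) ≤ n) 1+[ℓ-1]≡ℓ (#roots-binomial (ℓ ∸ 1) (Z k))

    ∑fiber≡r*ℓ : ∑ fiber ≡ r *ℕ ℓ
    ∑fiber≡r*ℓ = begin
      ∑ fiber                                                    ≡⟨ sym (fieldSum-comm (λ x k → ind ((x ^ ℓ) == Z k))) ⟩
      fieldSum (λ x → ∑[ k < r ] (if (x ^ ℓ) == Z k then 1 else 0)) ≡⟨ sum-cong-≗ (λ i → one-fiber (to i)) ⟩
      fieldSum (λ x → if x == 0# then 0 else 1)                  ≡⟨ count-≢0 ⟩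
      q ∸ 1                                                      ≡⟨ sym ℓ*r≡q-1 ⟩
      ℓ *ℕ r                                                     ≡⟨ ℕ.*-comm ℓ r ⟩
      r *ℕ ℓ                                                     ∎
      where
      open ≡-Reasoning
      one-fiber : ∀ x → ∑[ k < r ] (if (x ^ ℓ) == Z k then 1 else 0) ≡ (if x == 0# then 0 else 1)
      one-fiber x with x ≟ 0#
      ... | yes refl = trans (∑-select-∉ Z (λ _ → 1) 0^ℓ∉⟨ζ⟩) (sym (if-== refl))
      ... | no x≢0 = let k , x^ℓ≡Zk = x^ℓ∈⟨ζ⟩ x≢0 in
        trans (∑-select Z-injective (λ _ → 1) k x^ℓ≡Zk) (sym (if-≠ x≢0))

    fiber≡ℓ : ∀ k → fiber k ≡ ℓ
    fiber≡ℓ = ∑-bounded-attained⇒≡ fiber ℓ fiber≤ℓ ∑fiber≡r*ℓ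

    onCycleOfLength-decomposition : ∀ L x → ind (onCycleOfLength f L x) ≡
      (if x == 0# then ind (1 ≡ᵇ L) else 0) +ℕ ∑[ k < r ] (if (x ^ ℓ) == Z k then ind (ms k ≡ᵇ L) else 0)
    onCycleOfLength-decomposition L x with x ≟ 0#
    ... | yes refl = begin
      ind (onCycleOfLength f L 0#)  ≡⟨ cong ind (onCycleOfLength-period (fixed⇒period-1 f0≡0) L) ⟩
      ind (1 ≡ᵇ L)                  ≡⟨ sym (ℕ.+-identityʳ _) ⟩
      ind (1 ≡ᵇ L) +ℕ 0             ≡⟨ cong₂ _+ℕ_ (sym (if-== refl)) (sym (∑-select-∉ Z (λ k → ind (ms k ≡ᵇ L)) 0^ℓ∉⟨ζ⟩)) ⟩
      (if 0# == 0# then ind (1 ≡ᵇ L) else 0) +ℕ ∑[ k < r ] (if (0# ^ ℓ) == Z k then ind (ms k ≡ᵇ L) else 0) ∎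
      where open ≡-Reasoning
    ... | no x≢0 = let k , x^ℓ≡Zk = x^ℓ∈⟨ζ⟩ x≢0 in
      trans (cong ind (onCycleOfLength-period (iter-scaling⇒period x≢0 (ord-u k) (iter-f-on-fiber k x^ℓ≡Zk)) L))
            (sym (cong₂ _+ℕ_ (if-≠ x≢0) (∑-select Z-injective (λ k → ind (ms k ≡ᵇ L)) k x^ℓ≡Zk)))

    #onCycleOfLength : ∀ L → count (onCycleOfLength f L) ≡ ind (1 ≡ᵇ L) +ℕ ∑[ k < r ] (ind (ms k ≡ᵇ L) *ℕ ℓ)
    #onCycleOfLength L = begin
      count (onCycleOfLength f L)
        ≡⟨ sum-cong-≗ (λ i → onCycleOfLength-decomposition L (to i)) ⟩
      fieldSum (λ x → at0 x +ℕ ∑[ k < r ] onFiber x k)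
        ≡⟨ fieldSum-+ at0 (λ x → ∑[ k < r ] onFiber x k) ⟩
      fieldSum at0 +ℕ fieldSum (λ x → ∑[ k < r ] onFiber x k)
        ≡⟨ cong₂ _+ℕ_ (fieldSum-δ 0# (ind (1 ≡ᵇ L))) (fieldSum-comm onFiber) ⟩
      ind (1 ≡ᵇ L) +ℕ ∑[ k < r ] fieldSum (λ x → onFiber x k)
        ≡⟨ cong (ind (1 ≡ᵇ L) +ℕ_) (sum-cong-≗ (λ k →
             trans (fieldSum-if (λ x → (x ^ ℓ) == Z k) (ind (ms k ≡ᵇ L))) (cong (ind (ms k ≡ᵇ L) *ℕ_) (fiber≡ℓ k)))) ⟩
      ind (1 ≡ᵇ L) +ℕ ∑[ k < r ] (ind (ms k ≡ᵇ L) *ℕ ℓ) ∎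
      where
      open ≡-Reasoning
      at0 : Carrier → ℕ
      at0 x = if x == 0# then ind (1 ≡ᵇ L) else 0
      onFiber : Carrier → Fin r → ℕ
      onFiber x k = if (x ^ ℓ) == Z k then ind (ms k ≡ᵇ L) else 0

    cycleCount : Fin r → ℕ
    cycleCount k = (d *ℕ (m div ms k)) div r

    cycles : ℕ → Fin r → ℕ
    cycles L k = if ms k ≡ᵇ L then cycleCount k else 0

    ℓ≡ms*cycleCount : ∀ k → ℓ ≡ ms k *ℕ cycleCount k
    ℓ≡ms*cycleCount k with ms k | ms∣m k | proj₁ (ord-u k)
    ... | suc s | divides a m≡a*s | _ = begin
      ℓ                                ≡⟨ trans ℓ≡m*b (cong (_*ℕ b) m≡a*s) ⟩
      a *ℕ suc s *ℕ b                  ≡⟨ a*s*b≡s*[a*b] a (suc s) b ⟩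
      suc s *ℕ (a *ℕ b)                ≡⟨ cong (suc s *ℕ_) (sym (m*n/n≡m (a *ℕ b) r)) ⟩
      suc s *ℕ (a *ℕ b *ℕ r / r)       ≡⟨ cong (λ t → suc s *ℕ (t / r)) a*b*r≡d*a ⟩
      suc s *ℕ (d *ℕ a / r)            ≡⟨ cong (λ t → suc s *ℕ (d *ℕ t / r)) (sym m/s≡a) ⟩
      suc s *ℕ (d *ℕ (m / suc s) / r)  ∎
      where
      open ≡-Reasoning
      a*s*b≡s*[a*b] : ∀ a s b → a *ℕ s *ℕ b ≡ s *ℕ (a *ℕ b)
      a*s*b≡s*[a*b] = solve-∀
      a*b*r≡d*a : a *ℕ b *ℕ r ≡ d *ℕ a
      a*b*r≡d*a = trans (ℕ.*-assoc a b r) (trans (ℕ.*-comm a (b *ℕ r)) (cong (_*ℕ a) (sym d≡b*r)))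
      m/s≡a : m / suc s ≡ a
      m/s≡a = trans (cong (_/ suc s) m≡a*s) (m*n/n≡m a (suc s))

    ind*ℓ≡L*cycles : ∀ L k → ind (ms k ≡ᵇ suc L) *ℕ ℓ ≡ suc L *ℕ cycles (suc L) k
    ind*ℓ≡L*cycles L k with ms k ℕ.≟ suc L
    ... | yes ms≡L rewrite ≡ᵇ-true ms≡L =
      trans (ℕ.*-identityˡ ℓ) (trans (ℓ≡ms*cycleCount k) (cong (_*ℕ cycleCount k) ms≡L))
    ... | no  ms≢L rewrite ≡ᵇ-false ms≢L = sym (ℕ.*-zeroʳ (suc L))

    numCycles-f : ∀ L → numCycles f (suc L) ≡ (if suc L ≡ᵇ 1 then 1 else 0) +ℕ sum (map (cycles (suc L)) (allFin r))
    numCycles-f L = begin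
      length (filterᵇ (onCycleOfLength f (suc L)) elements) / suc L
        ≡⟨ cong (_/ suc L) (trans (length-filterᵇ-map-allFin q to (onCycleOfLength f (suc L))) (#onCycleOfLength (suc L))) ⟩
      (ind (1 ≡ᵇ suc L) +ℕ ∑[ k < r ] (ind (ms k ≡ᵇ suc L) *ℕ ℓ)) / suc L
        ≡⟨ cong (λ t → (ind (1 ≡ᵇ suc L) +ℕ t) / suc L)
                (trans (sum-cong-≗ (ind*ℓ≡L*cycles L)) (sym (*-distribˡ-sum (suc L) (cycles (suc L))))) ⟩
      (ind (1 ≡ᵇ suc L) +ℕ suc L *ℕ ∑ (cycles (suc L))) / suc L
        ≡⟨ [ind[1≡L]+L*n]/L≡ind[L≡1]+n L (∑ (cycles (suc L))) ⟩
      ind (suc L ≡ᵇ 1) +ℕ ∑ (cycles (suc L))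
        ≡⟨ cong (ind (suc L ≡ᵇ 1) +ℕ_) (sym (sum-map-allFin r (cycles (suc L)))) ⟩
      ind (suc L ≡ᵇ 1) +ℕ sum (map (cycles (suc L)) (allFin r)) ∎
      where open ≡-Reasoning

    G' : Fin r → Carrier
    G' = powMod (m ∸ 1) G

    u*u^[m-1]≡1 : ∀ k → u k * u k ^ (m ∸ 1) ≡ 1#
    u*u^[m-1]≡1 k = trans (cong (u k ^_) (ℕ.m+[n∸m]≡n 1≤m)) (HasOrder⇒^≡1 (ord-u k) (ms∣m k))

    G'[ζᵏ]≡u^[m-1] : ∀ k → evalPoly G' (Z k) ≡ u k ^ (m ∸ 1)
    G'[ζᵏ]≡u^[m-1] k = trans (evalPoly-powMod r' (m ∸ 1) G (Z k) (Z[k]^r≡1 k)) (cong (_^ (m ∸ 1)) (G[ζᵏ]≡u k))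

    G'[ζᵏ]≡u⁻¹ : ∀ k → evalPoly G' (Z k) ≡ u k ⁻¹
    G'[ζᵏ]≡u⁻¹ k = trans (G'[ζᵏ]≡u^[m-1] k) (inverse-unique (HasOrder⇒≢0 (ord-u k)) (u*u^[m-1]≡1 k))

    f⁻¹ : Carrier → Carrier
    f⁻¹ x = x * evalPoly G' (x ^ ℓ)

    f⁻¹∘f : ∀ x → f⁻¹ (f x) ≡ x
    f⁻¹∘f x with x ≟ 0#
    ... | yes refl = trans (cong f⁻¹ f0≡0) (zeroˡ _)
    ... | no x≢0 = let k , x^ℓ≡Zk = x^ℓ∈⟨ζ⟩ x≢0 in begin
      f⁻¹ (f x)                    ≡⟨ cong f⁻¹ (f-on-fiber k x^ℓ≡Zk) ⟩
      f⁻¹ (x * u k)                ≡⟨ cong (λ y → x * u k * evalPoly G' y)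
                                              (trans (^ℓ-*-invariant x (u^ℓ≡1 k)) x^ℓ≡Zk) ⟩
      x * u k * evalPoly G' (Z k)  ≡⟨ cong (x * u k *_) (G'[ζᵏ]≡u^[m-1] k) ⟩
      x * u k * u k ^ (m ∸ 1)      ≡⟨ *-assoc x (u k) _ ⟩
      x * (u k * u k ^ (m ∸ 1))    ≡⟨ cong (x *_) (u*u^[m-1]≡1 k) ⟩
      x * 1#                       ≡⟨ *-identityʳ x ⟩
      x                            ∎
      where open ≡-Reasoning

    f∘f⁻¹ : ∀ x → f (f⁻¹ x) ≡ x
    f∘f⁻¹ x with x ≟ 0#
    ... | yes refl = trans (cong f (zeroˡ _)) f0≡0
    ... | no x≢0 = let k , x^ℓ≡Zk = x^ℓ∈⟨ζ⟩ x≢0 in begin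
      f (f⁻¹ x)                    ≡⟨ cong (λ y → f (x * evalPoly G' y)) x^ℓ≡Zk ⟩
      f (x * evalPoly G' (Z k))    ≡⟨ cong (λ y → f (x * y)) (G'[ζᵏ]≡u^[m-1] k) ⟩
      f (x * u k ^ (m ∸ 1))        ≡⟨ f-on-fiber k (trans (^ℓ-*-invariant x ([u^j]^ℓ≡1 k (m ∸ 1))) x^ℓ≡Zk) ⟩
      x * u k ^ (m ∸ 1) * u k      ≡⟨ *-assoc x _ (u k) ⟩
      x * (u k ^ (m ∸ 1) * u k)    ≡⟨ cong (x *_) (trans (*-comm _ (u k)) (u*u^[m-1]≡1 k)) ⟩
      x * 1#                       ≡⟨ *-identityʳ x ⟩
      x                            ∎
      where open ≡-Reasoning

    f-bijective : Bijective _≡_ _≡_ f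
    f-bijective = inverseᵇ⇒bijective (strictlyInverseˡ⇒inverseˡ f f∘f⁻¹ , strictlyInverseʳ⇒inverseʳ f f⁻¹∘f)

mainTheorem6 :
    (r q : ℕ) → 1 < r →
    (∃[ p ] ∃[ e ] (Prime p × ¬ (2 ∣ p) × 1 ≤ e × q ≡ p ^ℕ e)) →
    r ∣ (q ∸ 1) →
    (F : FiniteField q) → let open FiniteField F in
    (ζ : Carrier) → HasOrder ζ r →
    (m d : ℕ) → 1 ≤ m → 1 ≤ d → q ∸ 1 ≡ m *ℕ d → r ∣ d → r ≤ φ m →
    (u : Fin r → Carrier) → (∀ i → u i ≢ 0#) → (∃[ i ] ∃[ j ] u i ≢ u j) →
    (ms : Fin r → ℕ) → (∀ i → HasOrder (u i) (ms i)) → (∀ i → ms i ∣ m) →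
    (G : Fin r → Carrier) → (∀ k → evalPoly G (ζ ^ toℕ k) ≡ u k) →
    let n : Fin r → ℕ
        n i = m div ms i
        ℓ = (q ∸ 1) div r
        f : Carrier → Carrier
        f x = x * evalPoly G (x ^ ℓ)
    in
    -- (i) f is a permutation polynomial of F_q
    Bijective _≡_ _≡_ f
    -- (ii) cycle type 1 + m_0^{d n_0 / r} + ... + m_{r-1}^{d n_{r-1} / r}
    × (∀ L → 1 ≤ L →
         numCycles f L ≡
           (if L ≡ᵇ 1 then 1 else 0)
           +ℕ sum (map (λ i → if ms i ≡ᵇ L then (d *ℕ n i) div r else 0) (allFin r)))
    -- (iii) the inverse is x G'(x^ℓ) with deg G' ≤ r-1, G'(ζ^k) = u_k⁻¹
    × (∃[ G' ] ((∀ k → evalPoly {r} G' (ζ ^ toℕ k) ≡ (u k) ⁻¹)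
                × (∀ x → (f x) * evalPoly G' ((f x) ^ ℓ) ≡ x)
                × (∀ x → f (x * evalPoly G' (x ^ ℓ)) ≡ x)))
mainTheorem6 zero    _ ()
mainTheorem6 (suc r') q _ _ _ F ζ ord-ζ m d 1≤m 1≤d q-1≡md r∣d _ u _ _ ms ord-u ms∣m G G[ζᵏ]≡u =
  f-bijective ,
  (λ { (suc L) _ → numCycles-f L }) ,
  (G' , G'[ζᵏ]≡u⁻¹ , f⁻¹∘f , f∘f⁻¹)
  where open PermutationPolynomial.Properties F r' ζ ord-ζ m d 1≤m 1≤d q-1≡md r∣d u ms ord-u ms∣m G G[ζᵏ]≡u
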